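{- Let $k \geq 1$ be an integer, let $G=(V,E)$ be a connected $2k$-regular graph with an odd number of edges, and let $e \in E(G)$. Then there exist two graphs $G_{A} = (V,A)$ and $G_{B} = (V,B)$ such that $E(G) = A \cup B \cup \{e\}$, $\Delta(G_{A}) \leq k$ and $\Delta(G_{B}) \leq k$.
   Context: Graphs are finite, undirected, without loops, but may have multiple edges. $\Delta(H)$ denotes the maximum degree of a graph $H$. -}

module Defs where

open import Data.Nat using (ℕ; suc)
open import Data.Fin using (Fin; _≟_)
open import Data.Fin.Subset using (Subset; _∩_; ∣_∣)
open import Data.Vec using (tabulate)
open import Data.Bool using (_∨_)
open import Data.Product using (_×_; proj₁; proj₂)
open import Relation.Nullary using (¬_)
open import Relation.Nullary.Decidable using (isYes)
open import Relation.Binary.PropositionalEquality using (_≡_)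

-- A finite multigraph on vertex set Fin n with edge set Fin m.
-- Each edge has two (ordered, but irrelevant) endpoints; multiple edges allowed.
record Graph (n m : ℕ) : Set where
  field
    ends   : Fin m → Fin n × Fin n
    noLoop : ∀ f → ¬ (proj₁ (ends f) ≡ proj₂ (ends f))
open Graph public

incident : ∀ {n m} → Graph n m → Fin n → Subset m
incident G v = tabulate λ f → isYes (v ≟ proj₁ (ends G f)) ∨ isYes (v ≟ proj₂ (ends G f))

-- degree of v in G (no loops, so = number of incident edges)
degree : ∀ {n m} → Graph n m → Fin n → ℕ
degree G v = ∣ incident G v ∣

degreeIn : ∀ {n m} → Graph n m → Subset m → Fin n → ℕ
degreeIn G A v = ∣ A ∩ incident G v ∣

MaxDegree≤ : ∀ {n m} → Graph n m → Subset m → ℕ → Set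
MaxDegree≤ G A d = ∀ v → degreeIn G A v Data.Nat.≤ d

Regular : ∀ {n m} → Graph n m → ℕ → Set
Regular G d = ∀ v → degree G v ≡ d

data Walk {n m} (G : Graph n m) : Fin n → Fin n → Set where
  nil  : ∀ {u} → Walk G u u
  fwd  : ∀ {w} (f : Fin m) → Walk G (proj₂ (ends G f)) w → Walk G (proj₁ (ends G f)) w
  bwd  : ∀ {w} (f : Fin m) → Walk G (proj₁ (ends G f)) w → Walk G (proj₂ (ends G f)) w

Connected : ∀ {n m} → Graph n m → Set
Connected G = ∀ u v → Walk G u v

{-# OPTIONS --safe #-}
-- Deleting e = st from an Euler circuit of G leaves a trail from t to s through all other
-- edges, of even length since G has an odd number of edges. Colour its edges alternately
-- A, B, starting with A. Each pass of the trail through a vertex v uses one edge of each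
-- colour, the first edge (at t) is in A and the last (at s) in B, so
-- deg_A v + [v = s] = deg_B v + [v = t]; since the two sides add up to deg v = 2k, both are k.
-- The Euler circuit is built by Hierholzer's method: a walk along unused edges from x can only
-- get stuck at x, because every other vertex is incident to an odd number of used edges, and
-- by connectivity some vertex of an incomplete circuit has an unused edge, where such a closed
-- detour is spliced in.
module Submission where

open import Defs
import Algebra.Properties.CommutativeMonoid.Sum as MonoidSum
open import Data.Bool using (Bool; true; false; _∧_; _∨_)
open import Data.Fin using (Fin; zero; suc; _≟_)
open import Data.Fin.Properties using (any?)
open import Data.Fin.Subset using (Subset; _∈_; _∩_; ∣_∣)
open import Data.List using (List; []; _∷_; _++_; map; length)
open import Data.List.Properties using (map-++; ++-assoc; ++-identityʳ; length-++; length-map)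
open import Data.Nat using (ℕ; _≥_; zero; suc; _+_; _*_; _≤_; _<_; z≤n; s≤s; z<s; _<?_; parity) renaming (_≟_ to _≟ℕ_)
open import Data.Nat.Properties
  using ( +-assoc; +-comm; +-suc; +-identityʳ; *-identityˡ; *-identityʳ; *-distribʳ-+
        ; ≤-refl; ≤-reflexive; ≤-trans; ≤-antisym; <-irrefl; <⇒≱; ≮⇒≥; n≤0⇒n≡0; n≤1⇒n≡0∨n≡1; n≢0⇒n>0
        ; m≤m+n; m≤n+m; m<m+n; m≤n*m; +-mono-≤; +-monoˡ-≤; *-monoʳ-≤; *-cancelˡ-≤
        ; +-0-commutativeMonoid; module ≤-Reasoning )
open import Data.Parity.Base as ℙ using (0ℙ; 1ℙ; _⁻¹)
import Data.Parity.Properties as ℙₚ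
open ℙₚ using (+-homo-+; *-homo-*; suc-homo-⁻¹; p+p≡0ℙ)
open import Data.Product using (Σ; ∃; _×_; _,_; proj₁; proj₂)
open import Data.Sum as Sum using (_⊎_; inj₁; inj₂)
open import Function using (_∘_; case_of_)
open import Data.Vec using ([]; _∷_; tabulate; lookup)
open import Data.Vec.Properties using (lookup∘tabulate; lookup-zipWith; lookup⇒[]=)
open import Relation.Nullary using (¬_; yes; no; contradiction; _×-dec_)
open import Relation.Nullary.Negation using (¬∃⟶∀¬)
open import Relation.Nullary.Decidable using (isYes; does; dec-true)
open import Relation.Binary.PropositionalEquality
open import Data.Nat.Solver using (module +-*-Solver)
open +-*-Solver using (solve; _:+_; _:=_)

open MonoidSum +-0-commutativeMonoid using (sum-cong-≗; ∑-distrib-+; sum-replicate-zero)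
  renaming (sum to ∑)

0<+ : ∀ a {b} → 0 < a + b → 0 < a ⊎ 0 < b
0<+ zero    b>0 = inj₂ b>0
0<+ (suc a) _   = inj₁ z<s

refuel : ∀ {k a b fuel} → k ≤ a + suc fuel → a < b → k ≤ b + fuel
refuel {a = a} {fuel = fuel} bound a<b = ≤-trans bound (≤-trans (≤-reflexive (+-suc a fuel)) (+-monoˡ-≤ fuel a<b))

out-of-fuel : ∀ {k a b} → k ≤ a + 0 → a < b → ¬ b ≤ k
out-of-fuel {k} {a} bound a<b b≤k = <⇒≱ a<b (≤-trans b≤k (subst (k ≤_) (+-identityʳ a) bound))

length-<-++ : {A : Set} (xs : List A) {y : A} {ys : List A} → length xs < length (xs ++ y ∷ ys)
length-<-++ xs = subst (length xs <_) (sym (length-++ xs)) (m<m+n (length xs) z<s)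

bit : Bool → ℕ
bit true  = 1
bit false = 0

δ : ∀ {k} → Fin k → Fin k → ℕ
δ i j = bit (isYes (i ≟ j))

δ-refl : ∀ {k} (i : Fin k) → δ i i ≡ 1
δ-refl i with i ≟ i
... | yes _ = refl
... | no i≢i = contradiction refl i≢i

δ-≢ : ∀ {k} {i j : Fin k} → i ≢ j → δ i j ≡ 0
δ-≢ {i = i} {j} i≢j with i ≟ j
... | yes i≡j = contradiction i≡j i≢j
... | no _ = refl

δ-suc : ∀ {k} (i j : Fin k) → δ (suc i) (suc j) ≡ δ i j
δ-suc i j with i ≟ j
... | yes _ = refl
... | no _ = refl

sumOver : {A : Set} → (A → ℕ) → List A → ℕ
sumOver h []       = 0
sumOver h (x ∷ xs) = h x + sumOver h xs

sumOver-++ : {A : Set} (h : A → ℕ) (xs ys : List A) → sumOver h (xs ++ ys) ≡ sumOver h xs + sumOver h ys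
sumOver-++ h []       ys = refl
sumOver-++ h (x ∷ xs) ys = trans (cong (h x +_) (sumOver-++ h xs ys)) (sym (+-assoc (h x) _ _))

length≡sumOver : {A : Set} (xs : List A) → length xs ≡ sumOver (λ _ → 1) xs
length≡sumOver []       = refl
length≡sumOver (_ ∷ xs) = cong suc (length≡sumOver xs)

alternate : {A : Set} → List A → List A × List A
alternate []       = [] , []
alternate (x ∷ xs) = x ∷ proj₂ (alternate xs) , proj₁ (alternate xs)

sumOver-alternate : {A : Set} (h : A → ℕ) (xs : List A) →
  sumOver h xs ≡ sumOver h (proj₁ (alternate xs)) + sumOver h (proj₂ (alternate xs))
sumOver-alternate h []       = refl
sumOver-alternate h (x ∷ xs) = begin
  h x + sumOver h xs      ≡⟨ cong (h x +_) (sumOver-alternate h xs) ⟩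
  h x + (odd + even)      ≡⟨ cong (h x +_) (+-comm odd even) ⟩
  h x + (even + odd)      ≡⟨ +-assoc (h x) even odd ⟨
  h x + even + odd        ∎
  where
  open ≡-Reasoning
  odd  = sumOver h (proj₁ (alternate xs))
  even = sumOver h (proj₂ (alternate xs))

∑-one : ∀ m → ∑ {m} (λ _ → 1) ≡ m
∑-one zero    = refl
∑-one (suc m) = cong suc (∑-one m)

∑-mono-≤ : ∀ {m} {g h : Fin m → ℕ} → (∀ f → g f ≤ h f) → ∑ g ≤ ∑ h
∑-mono-≤ {zero}  g≤h = z≤n
∑-mono-≤ {suc m} g≤h = +-mono-≤ (g≤h zero) (∑-mono-≤ (λ f → g≤h (suc f)))

∑-δ : ∀ {m} (g : Fin m) (h : Fin m → ℕ) → ∑ (λ f → δ f g * h f) ≡ h g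
∑-δ {suc m} zero    h = begin
  h zero + 0 + ∑ {m} (λ _ → 0) ≡⟨ cong₂ _+_ (+-identityʳ (h zero)) (sum-replicate-zero m) ⟩
  h zero + 0                   ≡⟨ +-identityʳ (h zero) ⟩
  h zero                       ∎
  where open ≡-Reasoning
∑-δ {suc m} (suc g) h = begin
  ∑ (λ f → δ (suc f) (suc g) * h (suc f)) ≡⟨ sum-cong-≗ (λ f → cong (_* h (suc f)) (δ-suc f g)) ⟩
  ∑ (λ f → δ f g * h (suc f))             ≡⟨ ∑-δ g (λ f → h (suc f)) ⟩
  h (suc g)                               ∎
  where open ≡-Reasoning

∣p∣≡∑ : ∀ {m} (p : Subset m) → ∣ p ∣ ≡ ∑ (λ f → bit (lookup p f))
∣p∣≡∑ []          = refl
∣p∣≡∑ (true  ∷ p) = cong suc (∣p∣≡∑ p)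
∣p∣≡∑ (false ∷ p) = ∣p∣≡∑ p

module _ {m : ℕ} where

  multiplicity : Fin m → List (Fin m) → ℕ
  multiplicity f = sumOver (δ f)

  Distinct : List (Fin m) → Set
  Distinct fs = ∀ f → multiplicity f fs ≤ 1

  Enumerates : List (Fin m) → Set
  Enumerates fs = ∀ f → multiplicity f fs ≡ 1

  sumOver≡∑ : (h : Fin m → ℕ) (fs : List (Fin m)) → sumOver h fs ≡ ∑ (λ f → multiplicity f fs * h f)
  sumOver≡∑ h []       = sym (sum-replicate-zero m)
  sumOver≡∑ h (g ∷ fs) = begin
    h g + sumOver h fs
      ≡⟨ cong₂ _+_ (∑-δ g h) (sym (sumOver≡∑ h fs)) ⟨
    ∑ (λ f → δ f g * h f) + ∑ (λ f → multiplicity f fs * h f)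
      ≡⟨ ∑-distrib-+ (λ f → δ f g * h f) (λ f → multiplicity f fs * h f) ⟨
    ∑ (λ f → δ f g * h f + multiplicity f fs * h f)
      ≡⟨ sum-cong-≗ (λ f → *-distribʳ-+ (h f) (δ f g) (multiplicity f fs)) ⟨
    ∑ (λ f → multiplicity f (g ∷ fs) * h f) ∎
    where open ≡-Reasoning

  sumOver-enumeration : ∀ {fs} → Enumerates fs → (h : Fin m → ℕ) → sumOver h fs ≡ ∑ h
  sumOver-enumeration {fs} once h = trans (sumOver≡∑ h fs) (sum-cong-≗ λ f → begin
    multiplicity f fs * h f ≡⟨ cong (_* h f) (once f) ⟩
    1 * h f                 ≡⟨ *-identityˡ (h f) ⟩
    h f                     ∎)
    where open ≡-Reasoning

  length-distinct : ∀ {fs} → Distinct fs → length fs ≤ m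
  length-distinct {fs} distinct = begin
    length fs                               ≡⟨ length≡sumOver fs ⟩
    sumOver (λ _ → 1) fs                    ≡⟨ sumOver≡∑ (λ _ → 1) fs ⟩
    ∑ (λ f → multiplicity f fs * 1)         ≤⟨ ∑-mono-≤ (λ f → ≤-trans (≤-reflexive (*-identityʳ _)) (distinct f)) ⟩
    ∑ {m} (λ _ → 1)                         ≡⟨ ∑-one m ⟩
    m                                       ∎
    where open ≤-Reasoning

  members : List (Fin m) → Subset m
  members fs = tabulate λ f → does (0 <? multiplicity f fs)

  ∈-members : ∀ {f fs} → 0 < multiplicity f fs → f ∈ members fs
  ∈-members {f} {fs} f∈fs =
    lookup⇒[]= f (members fs) (trans (lookup∘tabulate _ f) (dec-true (0 <? multiplicity f fs) f∈fs))

  lookup-members∧ : ∀ fs f b → bit (lookup (members fs) f ∧ b) ≤ multiplicity f fs * bit b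
  lookup-members∧ fs f b rewrite lookup∘tabulate (λ g → does (0 <? multiplicity g fs)) f
    with multiplicity f fs
  ... | zero  = z≤n
  ... | suc k = m≤n*m (bit b) (suc k)

  distinct-snoc : ∀ {fs g} → Distinct fs → multiplicity g fs ≡ 0 → Distinct (fs ++ g ∷ [])
  distinct-snoc {fs} {g} distinct fresh f rewrite sumOver-++ (δ f) fs (g ∷ []) with f ≟ g
  ... | yes refl rewrite fresh = ≤-refl
  ... | no _     = subst (_≤ 1) (sym (+-identityʳ (multiplicity f fs))) (distinct f)

  even-length-enumeration : ∀ {e fs} → Enumerates (e ∷ fs) → parity m ≡ 1ℙ → parity (length fs) ≡ 0ℙ
  even-length-enumeration {e} {fs} once odd-size = begin
    parity (length fs)                ≡⟨ suc-homo-⁻¹ (length fs) ⟨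
    parity (suc (length fs)) ⁻¹       ≡⟨ cong (λ l → parity l ⁻¹) size ⟩
    parity m ⁻¹                       ≡⟨ cong _⁻¹ odd-size ⟩
    0ℙ                                ∎
    where
    open ≡-Reasoning
    size : suc (length fs) ≡ m
    size = trans (length≡sumOver (e ∷ fs)) (trans (sumOver-enumeration {fs = e ∷ fs} once (λ _ → 1)) (∑-one m))

  members-alternate-cover : ∀ {e fs} → Enumerates (e ∷ fs) →
    ∀ f → f ∈ members (proj₁ (alternate fs)) ⊎ f ∈ members (proj₂ (alternate fs)) ⊎ f ≡ e
  members-alternate-cover {e} {fs} once f with f ≟ e
  ... | yes f≡e = inj₂ (inj₂ f≡e)
  ... | no f≢e  = Sum.map (∈-members {fs = odd}) (inj₁ ∘ ∈-members {fs = even}) (0<+ (multiplicity f odd) (subst (0 <_) (sym split-count) z<s))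
    where
    open ≡-Reasoning
    odd  = proj₁ (alternate fs)
    even = proj₂ (alternate fs)
    split-count : multiplicity f odd + multiplicity f even ≡ 1
    split-count = begin
      multiplicity f odd + multiplicity f even ≡⟨ sumOver-alternate (δ f) fs ⟨
      multiplicity f fs                        ≡⟨ cong (_+ multiplicity f fs) (δ-≢ f≢e) ⟨
      multiplicity f (e ∷ fs)                  ≡⟨ once f ⟩
      1                                        ∎

parity-telescope : ∀ a b c → parity (a + b) ℙ.+ parity (b + c) ≡ parity (a + c)
parity-telescope a b c = begin
  parity (a + b) ℙ.+ parity (b + c) ≡⟨ cong₂ ℙ._+_ (+-homo-+ a b) (+-homo-+ b c) ⟩
  (p ℙ.+ q) ℙ.+ (q ℙ.+ r)           ≡⟨ ℙₚ.+-assoc p q (q ℙ.+ r) ⟩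
  p ℙ.+ (q ℙ.+ (q ℙ.+ r))           ≡⟨ cong (p ℙ.+_) (ℙₚ.+-assoc q q r) ⟨
  p ℙ.+ ((q ℙ.+ q) ℙ.+ r)           ≡⟨ cong (λ x → p ℙ.+ (x ℙ.+ r)) (p+p≡0ℙ q) ⟩
  p ℙ.+ r                           ≡⟨ +-homo-+ a c ⟨
  parity (a + c)                    ∎
  where
  open ≡-Reasoning
  p = parity a
  q = parity b
  r = parity c

parity-double : ∀ a → parity (a + a) ≡ 0ℙ
parity-double a = trans (+-homo-+ a a) (p+p≡0ℙ (parity a))

module _ {n m : ℕ} (G : Graph n m) where

  endsAt : Fin n → Fin m → ℕ
  endsAt v f = δ v (proj₁ (ends G f)) + δ v (proj₂ (ends G f))

  hits : Fin n → List (Fin m) → ℕ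
  hits v = sumOver (endsAt v)

  endsAt≡incident : ∀ v f → endsAt v f ≡ bit (lookup (incident G v) f)
  endsAt≡incident v f rewrite lookup∘tabulate (λ g → isYes (v ≟ proj₁ (ends G g)) ∨ isYes (v ≟ proj₂ (ends G g))) f
    with v ≟ proj₁ (ends G f) | v ≟ proj₂ (ends G f)
  ... | yes v≡s | yes v≡t = contradiction (trans (sym v≡s) v≡t) (noLoop G f)
  ... | yes _   | no _    = refl
  ... | no _    | yes _   = refl
  ... | no _    | no _    = refl

  degree≡∑endsAt : ∀ v → degree G v ≡ ∑ (endsAt v)
  degree≡∑endsAt v = trans (∣p∣≡∑ (incident G v)) (sum-cong-≗ λ f → sym (endsAt≡incident v f))

  Dart : Set
  Dart = Fin m × Bool

  edge : Dart → Fin m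
  edge = proj₁

  edges : List Dart → List (Fin m)
  edges = map edge

  source target : Dart → Fin n
  source (f , false) = proj₁ (ends G f)
  source (f , true)  = proj₂ (ends G f)
  target (f , false) = proj₂ (ends G f)
  target (f , true)  = proj₁ (ends G f)

  endsAt-dart : ∀ v d → endsAt v (edge d) ≡ δ v (source d) + δ v (target d)
  endsAt-dart v (f , false) = refl
  endsAt-dart v (f , true)  = +-comm (δ v (proj₁ (ends G f))) _

  data DartWalk : Fin n → Fin n → List Dart → Set where
    []   : ∀ {u} → DartWalk u u []
    step : ∀ {u w ds} d → source d ≡ u → DartWalk (target d) w ds → DartWalk u w (d ∷ ds)

  walk-++ : ∀ {u x w ds es} → DartWalk u x ds → DartWalk x w es → DartWalk u w (ds ++ es)
  walk-++ []                 q = q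
  walk-++ (step d d≡u p) q = step d d≡u (walk-++ p q)

  -- fs is a T-join for T = {a, b}: its odd-degree vertices are a and b (none if a ≡ b).
  IsJoin : Fin n → Fin n → List (Fin m) → Set
  IsJoin a b fs = ∀ v → parity (hits v fs) ≡ parity (δ v a + δ v b)

  join-++ : ∀ {a b c fs gs} → IsJoin a b fs → IsJoin b c gs → IsJoin a c (fs ++ gs)
  join-++ {a} {b} {c} {fs} {gs} ab bc v = begin
    parity (hits v (fs ++ gs))                          ≡⟨ cong parity (sumOver-++ (endsAt v) fs gs) ⟩
    parity (hits v fs + hits v gs)                      ≡⟨ +-homo-+ (hits v fs) (hits v gs) ⟩
    parity (hits v fs) ℙ.+ parity (hits v gs)           ≡⟨ cong₂ ℙ._+_ (ab v) (bc v) ⟩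
    parity (δ v a + δ v b) ℙ.+ parity (δ v b + δ v c)   ≡⟨ parity-telescope (δ v a) (δ v b) (δ v c) ⟩
    parity (δ v a + δ v c)                              ∎
    where open ≡-Reasoning

  join-closed : ∀ {a b fs} → IsJoin a a fs → IsJoin b b fs
  join-closed {a} {b} closed v = trans (closed v) (trans (parity-double (δ v a)) (sym (parity-double (δ v b))))

  walk-join : ∀ {u w ds} → DartWalk u w ds → IsJoin u w (edges ds)
  walk-join {u} []              v = sym (parity-double (δ v u))
  walk-join {w = w} (step {ds = ds} d refl walk) = join-++ {fs = edge d ∷ []} {gs = edges ds} dart-join (walk-join walk)
    where
    dart-join : IsJoin (source d) (target d) (edge d ∷ [])
    dart-join v = cong parity (trans (+-identityʳ (endsAt v (edge d))) (endsAt-dart v d))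

  -- Every interior vertex of the walk is entered along one colour class and left along the other.
  alternating-balance : ∀ {u w ds} → DartWalk u w ds → parity (length ds) ≡ 0ℙ → ∀ v →
    hits v (proj₁ (alternate (edges ds))) + δ v w ≡ hits v (proj₂ (alternate (edges ds))) + δ v u
  alternating-balance []                                   _    v = refl
  alternating-balance (step d _ [])                        ()
  alternating-balance {u} {w} (step d refl (step {ds = ds} e e≡ walk)) even-length v = begin
    endsAt v (edge d) + odd + δ v w         ≡⟨ +-assoc (endsAt v (edge d)) odd (δ v w) ⟩
    endsAt v (edge d) + (odd + δ v w)       ≡⟨ cong₂ _+_ (endsAt-dart v d) (alternating-balance walk even-length v) ⟩
    (δ v u + δ v x) + (even + δ v y)       ≡⟨ solve 4 (λ a b c d → (a :+ b) :+ (c :+ d) := (b :+ d :+ c) :+ a) refl (δ v u) (δ v x) even (δ v y) ⟩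
    (δ v x + δ v y + even) + δ v u         ≡⟨ cong (λ z → (δ v z + δ v y + even) + δ v u) e≡ ⟨
    (δ v (source e) + δ v y + even) + δ v u ≡⟨ cong (λ z → z + even + δ v u) (endsAt-dart v e) ⟨
    endsAt v (edge e) + even + δ v u       ∎
    where
    open ≡-Reasoning
    x = target d
    y = target e
    odd = hits v (proj₁ (alternate (edges ds)))
    even = hits v (proj₂ (alternate (edges ds)))

  dart-leaving : ∀ {u f} → 0 < endsAt u f → Σ Dart λ d → edge d ≡ f × source d ≡ u
  dart-leaving {u} {f} u∈f with u ≟ proj₁ (ends G f) | u ≟ proj₂ (ends G f)
  ... | yes u≡s | _       = (f , false) , refl , sym u≡s
  ... | no _    | yes u≡t = (f , true) , refl , sym u≡t
  ... | no _    | no _    = contradiction u∈f (<-irrefl refl)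

  degreeIn-members : ∀ fs v → degreeIn G (members fs) v ≤ hits v fs
  degreeIn-members fs v = begin
    ∣ members fs ∩ incident G v ∣                                       ≡⟨ ∣p∣≡∑ (members fs ∩ incident G v) ⟩
    ∑ (λ f → bit (lookup (members fs ∩ incident G v) f))                 ≡⟨ sum-cong-≗ (λ f → cong bit (lookup-zipWith _∧_ f (members fs) (incident G v))) ⟩
    ∑ (λ f → bit (lookup (members fs) f ∧ lookup (incident G v) f))      ≤⟨ ∑-mono-≤ (λ f → lookup-members∧ fs f _) ⟩
    ∑ (λ f → multiplicity f fs * bit (lookup (incident G v) f))          ≡⟨ sum-cong-≗ (λ f → cong (multiplicity f fs *_) (endsAt≡incident v f)) ⟨
    ∑ (λ f → multiplicity f fs * endsAt v f)                             ≡⟨ sumOver≡∑ (endsAt v) fs ⟨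
    hits v fs                                                            ∎
    where open ≤-Reasoning

  EvenDegrees : Set
  EvenDegrees = ∀ v → parity (degree G v) ≡ 0ℙ

  hits-saturated : ∀ {u fs} → Distinct fs → (∀ f → multiplicity f fs ≡ 0 → endsAt u f ≡ 0) → hits u fs ≡ degree G u
  hits-saturated {u} {fs} distinct saturated = begin
    hits u fs                                ≡⟨ sumOver≡∑ (endsAt u) fs ⟩
    ∑ (λ f → multiplicity f fs * endsAt u f) ≡⟨ sum-cong-≗ counted-once ⟩
    ∑ (endsAt u)                             ≡⟨ degree≡∑endsAt u ⟨
    degree G u                               ∎
    where
    open ≡-Reasoning
    counted-once : ∀ f → multiplicity f fs * endsAt u f ≡ endsAt u f
    counted-once f with n≤1⇒n≡0∨n≡1 (distinct f)
    ... | inj₁ unused = trans (cong (_* endsAt u f) unused) (sym (saturated f unused))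
    ... | inj₂ once   = trans (cong (_* endsAt u f) once) (*-identityˡ (endsAt u f))

  unused-edge-at : EvenDegrees → ∀ {u fs} → Distinct fs → parity (hits u fs) ≡ 1ℙ →
    ∃ λ f → 0 < endsAt u f × multiplicity f fs ≡ 0
  unused-edge-at even-degrees {u} {fs} distinct odd with any? (λ f → 0 <? endsAt u f ×-dec multiplicity f fs ≟ℕ 0)
  ... | yes found = found
  ... | no none   = contradiction (trans (sym odd) (trans (cong parity (hits-saturated {u} {fs} distinct saturated)) (even-degrees u))) λ ()
    where
    saturated : ∀ f → multiplicity f fs ≡ 0 → endsAt u f ≡ 0
    saturated f unused = n≤0⇒n≡0 (≮⇒≥ λ u∈f → ¬∃⟶∀¬ none f (u∈f , unused))

  sumOver-splice : ∀ (h : Fin m → ℕ) P C S → sumOver h (edges (P ++ C ++ S)) ≡ sumOver h (edges (P ++ S)) + sumOver h (edges C)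
  sumOver-splice h P C S = begin
    sumOver h (edges (P ++ C ++ S))             ≡⟨ cong (sumOver h) (trans (map-++ edge P (C ++ S)) (cong (edges P ++_) (map-++ edge C S))) ⟩
    sumOver h (edges P ++ edges C ++ edges S)   ≡⟨ trans (sumOver-++ h (edges P) _) (cong (sumOver h (edges P) +_) (sumOver-++ h (edges C) _)) ⟩
    p + (c + s)                                 ≡⟨ solve 3 (λ p c s → p :+ (c :+ s) := (p :+ s) :+ c) refl p c s ⟩
    (p + s) + c                                 ≡⟨ cong (_+ c) (trans (cong (sumOver h) (map-++ edge P S)) (sumOver-++ h (edges P) (edges S))) ⟨
    sumOver h (edges (P ++ S)) + c              ∎
    where
    open ≡-Reasoning
    p = sumOver h (edges P)
    c = sumOver h (edges C)
    s = sumOver h (edges S)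

  record Split (u w : Fin n) (ds : List Dart) (x : Fin n) : Set where
    constructor split
    field
      prefix suffix : List Dart
      ds≡ : ds ≡ prefix ++ suffix
      walk-prefix : DartWalk u x prefix
      walk-suffix : DartWalk x w suffix

  split-start : ∀ {u w ds} → DartWalk u w ds → Split u w ds u
  split-start {ds = ds} walk = split [] ds refl [] walk

  split-end : ∀ {u w ds} → DartWalk u w ds → Split u w ds w
  split-end {ds = ds} walk = split ds [] (sym (++-identityʳ ds)) walk []

  split-step : ∀ {u w d ds x} → source d ≡ u → Split (target d) w ds x → Split u w (d ∷ ds) x
  split-step {d = d} d-from-u (split P S eq wP wS) = split (d ∷ P) S (cong (d ∷_) eq) (step d d-from-u wP) wS

  split-at-edge : ∀ {u w ds f} → DartWalk u w ds → 0 < multiplicity f (edges ds) →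
    Split u w ds (proj₁ (ends G f)) × Split u w ds (proj₂ (ends G f))
  split-at-edge {f = f} (step (g , b) refl walk) f∈ds with f ≟ g
  split-at-edge (step (g , false) refl walk) _ | yes refl = split-start (step _ refl walk) , split-step refl (split-start walk)
  split-at-edge (step (g , true)  refl walk) _ | yes refl = split-step refl (split-start walk) , split-start (step _ refl walk)
  split-at-edge (step d refl walk) f∈ds | no _ =
    let (at-s , at-t) = split-at-edge walk f∈ds
    in split-step refl at-s , split-step refl at-t

  module _ (even-degrees : EvenDegrees) where

    return-walk : ∀ {x u} fs → Distinct fs → IsJoin x u fs → ∃ λ ds → DartWalk u x ds × Distinct (fs ++ edges ds)
    return-walk fs = go m fs (m≤n+m m (length fs))
      where
      go : ∀ fuel {x u} fs → m ≤ length fs + fuel → Distinct fs → IsJoin x u fs →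
        ∃ λ ds → DartWalk u x ds × Distinct (fs ++ edges ds)
      go fuel {x} {u} fs bound distinct join with u ≟ x
      ... | yes refl = [] , [] , subst Distinct (sym (++-identityʳ fs)) distinct
      ... | no u≢x   = continue fuel bound (unused-edge-at even-degrees {u} {fs} distinct u-odd)
        where
        u-odd : parity (hits u fs) ≡ 1ℙ
        u-odd = trans (join u) (cong parity (cong₂ _+_ (δ-≢ u≢x) (δ-refl u)))
        continue : ∀ fuel → m ≤ length fs + fuel → (∃ λ f → 0 < endsAt u f × multiplicity f fs ≡ 0) →
          ∃ λ ds → DartWalk u x ds × Distinct (fs ++ edges ds)
        continue zero bound (f , _ , fresh) =
          contradiction (length-distinct {fs = fs ++ f ∷ []} (distinct-snoc {fs = fs} distinct fresh)) (out-of-fuel bound (length-<-++ fs))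
        continue (suc fuel) bound (f , u∈f , fresh) with dart-leaving {u} {f} u∈f
        ... | d , refl , d-from-u with go fuel (fs ++ edge d ∷ []) (refuel bound (length-<-++ fs))
                                          (distinct-snoc {fs = fs} distinct fresh)
                                          (join-++ {fs = fs} {gs = edge d ∷ []} join (walk-join (step d d-from-u [])))
        ...   | ds , walk , distinct′ = d ∷ ds , step d d-from-u walk , subst Distinct (++-assoc fs (edge d ∷ []) (edges ds)) distinct′

  module _ (e : Fin m) where

    private
      s t : Fin n
      s = proj₁ (ends G e)
      t = proj₂ (ends G e)

    Circuit : List Dart → Set
    Circuit R = DartWalk t s R × Distinct (e ∷ edges R)

    Unused : List Dart → Fin m → Set
    Unused R f = multiplicity f (e ∷ edges R) ≡ 0

    UnusedDartFrom : List Dart → Fin n → Set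
    UnusedDartFrom R x = ∃ λ d → source d ≡ x × Unused R (edge d)

    split-at-used : ∀ {R f} → DartWalk t s R → ¬ Unused R f → Split t s R (proj₁ (ends G f)) × Split t s R (proj₂ (ends G f))
    split-at-used {f = f} walk used with f ≟ e
    ... | yes refl = split-end walk , split-start walk
    ... | no _     = split-at-edge walk (n≢0⇒n>0 used)

    unused-dart-on : Connected G → ∀ {R g} → DartWalk t s R → Unused R g → ∃ λ x → Split t s R x × UnusedDartFrom R x
    unused-dart-on connected {R} {g} walk g-unused =
      follow (connected t (proj₁ (ends G g))) (split-start walk) ((g , false) , refl , g-unused)
      where
      follow : ∀ {v y} → Walk G v y → Split t s R v → UnusedDartFrom R y → ∃ λ x → Split t s R x × UnusedDartFrom R x
      follow nil at-v found = _ , at-v , found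
      follow (fwd f rest) at-v found with multiplicity f (e ∷ edges R) ≟ℕ 0
      ... | yes unused = _ , at-v , (f , false) , refl , unused
      ... | no used    = follow rest (proj₂ (split-at-used walk used)) found
      follow (bwd f rest) at-v found with multiplicity f (e ∷ edges R) ≟ℕ 0
      ... | yes unused = _ , at-v , (f , true) , refl , unused
      ... | no used    = follow rest (proj₁ (split-at-used walk used)) found

    module _ (even-degrees : EvenDegrees) (connected : Connected G) where

      extend-circuit : ∀ {R g} → Circuit R → Unused R g →
        ∃ λ R′ → Circuit R′ × length (e ∷ edges R) < length (e ∷ edges R′)
      extend-circuit {R} (walk , distinct) g-unused
        with unused-dart-on connected walk g-unused
      ... | x , split P S R≡P++S walk-P walk-S , d , d-from-x , d-unused
        with return-walk even-degrees (e ∷ edges R ++ edge d ∷ []) (distinct-snoc {fs = e ∷ edges R} distinct d-unused)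
               (join-++ {fs = e ∷ edges R} (join-closed {fs = e ∷ edges R} (walk-join (step (e , false) refl walk))) (walk-join (step d d-from-x [])))
      ... | Q , walk-Q , distinct-Q = P ++ (d ∷ Q) ++ S , (walk-++ walk-P (walk-++ (step d d-from-x walk-Q) walk-S) , distinct′) , longer
        where
        spliced : ∀ h → sumOver h (e ∷ edges R ++ edges (d ∷ Q)) ≡ sumOver h (e ∷ edges (P ++ (d ∷ Q) ++ S))
        spliced h = begin
          sumOver h (e ∷ edges R ++ edges (d ∷ Q))               ≡⟨ cong (h e +_) (sumOver-++ h (edges R) (edges (d ∷ Q))) ⟩
          h e + (sumOver h (edges R) + sumOver h (edges (d ∷ Q))) ≡⟨ cong (λ R → h e + (sumOver h (edges R) + sumOver h (edges (d ∷ Q)))) R≡P++S ⟩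
          h e + (sumOver h (edges (P ++ S)) + sumOver h (edges (d ∷ Q))) ≡⟨ cong (h e +_) (sumOver-splice h P (d ∷ Q) S) ⟨
          sumOver h (e ∷ edges (P ++ (d ∷ Q) ++ S))              ∎
          where open ≡-Reasoning
        distinct′ : Distinct (e ∷ edges (P ++ (d ∷ Q) ++ S))
        distinct′ f = subst (_≤ 1) (spliced (δ f)) (subst Distinct (++-assoc (e ∷ edges R) (edge d ∷ []) (edges Q)) distinct-Q f)
        longer : length (e ∷ edges R) < length (e ∷ edges (P ++ (d ∷ Q) ++ S))
        longer = subst (length (e ∷ edges R) <_)
          (trans (length≡sumOver (e ∷ edges R ++ edges (d ∷ Q))) (trans (spliced (λ _ → 1)) (sym (length≡sumOver (e ∷ edges (P ++ (d ∷ Q) ++ S))))))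
          (length-<-++ (e ∷ edges R) {ys = edges Q})

      complete-circuit : ∀ fuel R → Circuit R → m ≤ length (e ∷ edges R) + fuel →
        ∃ λ R → DartWalk t s R × Enumerates (e ∷ edges R)
      complete-circuit fuel R (walk , distinct) bound with any? (λ g → multiplicity g (e ∷ edges R) ≟ℕ 0)
      ... | no all-used        = R , walk , λ f → ≤-antisym (distinct f) (n≢0⇒n>0 (¬∃⟶∀¬ all-used f))
      ... | yes (g , g-unused) = continue fuel (extend-circuit (walk , distinct) g-unused) bound
        where
        continue : ∀ fuel → (∃ λ R′ → Circuit R′ × length (e ∷ edges R) < length (e ∷ edges R′)) →
          m ≤ length (e ∷ edges R) + fuel → ∃ λ R → DartWalk t s R × Enumerates (e ∷ edges R)
        continue zero       (R′ , (_ , distinct′) , longer) bound =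
          contradiction (length-distinct {fs = e ∷ edges R′} distinct′) (out-of-fuel bound longer)
        continue (suc fuel) (R′ , circuit′ , longer) bound = complete-circuit fuel R′ circuit′ (refuel bound longer)

      euler-circuit : ∃ λ R → DartWalk t s R × Enumerates (e ∷ edges R)
      euler-circuit = complete-circuit m (proj₁ start) (proj₂ start) (m≤n+m m _)
        where
        start : ∃ Circuit
        start = return-walk even-degrees (e ∷ []) (distinct-snoc {fs = []} (λ _ → z≤n) refl) (walk-join (step (e , false) refl []))

      euler-halving : parity m ≡ 1ℙ →
        Σ (Subset m) λ A → Σ (Subset m) λ B → (∀ f → f ∈ A ⊎ f ∈ B ⊎ f ≡ e) ×
          (∀ v → 2 * degreeIn G A v ≤ degree G v) × (∀ v → 2 * degreeIn G B v ≤ degree G v)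
      euler-halving odd-size with euler-circuit
      ... | R , walk , once =
        members odd , members even , members-alternate-cover {e = e} {fs = edges R} once ,
        halved odd (λ v → m≤m+n _ _) , halved even (λ v → ≤-trans (m≤m+n _ _) (≤-reflexive (balance v)))
        where
        odd even : List (Fin m)
        odd  = proj₁ (alternate (edges R))
        even = proj₂ (alternate (edges R))

        balance : ∀ v → hits v even + δ v t ≡ hits v odd + δ v s
        balance v = sym (alternating-balance walk (subst (λ l → parity l ≡ 0ℙ) (length-map edge R) (even-length-enumeration {e = e} {fs = edges R} once odd-size)) v)

        total : ∀ v → (hits v odd + δ v s) + (hits v even + δ v t) ≡ degree G v
        total v = begin
          (hits v odd + δ v s) + (hits v even + δ v t) ≡⟨ solve 4 (λ a b c d → (a :+ c) :+ (b :+ d) := (c :+ d) :+ (a :+ b)) refl (hits v odd) (hits v even) (δ v s) (δ v t) ⟩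
          endsAt v e + (hits v odd + hits v even)      ≡⟨ cong (endsAt v e +_) (sumOver-alternate (endsAt v) (edges R)) ⟨
          hits v (e ∷ edges R)                         ≡⟨ sumOver-enumeration {fs = e ∷ edges R} once (endsAt v) ⟩
          ∑ (endsAt v)                                 ≡⟨ degree≡∑endsAt v ⟨
          degree G v                                   ∎
          where open ≡-Reasoning

        share : Fin n → ℕ
        share v = hits v odd + δ v s

        twice-share : ∀ v → 2 * share v ≡ degree G v
        twice-share v = begin
          share v + (share v + 0)                      ≡⟨ cong (λ k → share v + k) (+-identityʳ (share v)) ⟩
          share v + share v                            ≡⟨ cong (share v +_) (balance v) ⟨
          (hits v odd + δ v s) + (hits v even + δ v t) ≡⟨ total v ⟩
          degree G v                                   ∎
          where open ≡-Reasoning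

        halved : ∀ half → (∀ v → hits v half ≤ share v) → ∀ v → 2 * degreeIn G (members half) v ≤ degree G v
        halved half below v = ≤-trans (*-monoʳ-≤ 2 (≤-trans (degreeIn-members half v) (below v))) (≤-reflexive (twice-share v))

lemma6 : (k n m : ℕ) → k ≥ 1 → (G : Graph n m) → Connected G → Regular G (2 * k)
    → (∃ λ j → m ≡ suc (2 * j)) → (e : Fin m)
    → Σ (Subset m) λ A → Σ (Subset m) λ B
    → (∀ f → f ∈ A ⊎ f ∈ B ⊎ f ≡ e) × MaxDegree≤ G A k × MaxDegree≤ G B k
lemma6 k n m _ G connected regular (j , m≡1+2j) e =
  case euler-halving G e even-degrees connected odd-size of λ where
    (A , B , covered , A-halved , B-halved) → A , B , covered , at-most-k A A-halved , at-most-k B B-halved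
  where
  even-degrees : EvenDegrees G
  even-degrees v = trans (cong parity (regular v)) (*-homo-* 2 k)
  odd-size : parity m ≡ 1ℙ
  odd-size = trans (cong parity m≡1+2j) (sym (ℙₚ.⁻¹-selfInverse (trans (suc-homo-⁻¹ (2 * j)) (*-homo-* 2 j))))
  at-most-k : ∀ X → (∀ v → 2 * degreeIn G X v ≤ degree G v) → MaxDegree≤ G X k
  at-most-k X halved v = *-cancelˡ-≤ 2 (subst (2 * degreeIn G X v ≤_) (regular v) (halved v))
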